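{- Let $p$ be an odd prime, $a$ a positive integer with $a<p$, and $n=ap^2+1$. If $p\mid\varphi(n)$, then $n$ is prime.
   Context: $\varphi$ denotes Euler's totient function. -}

module Defs where

open import Data.Nat using (ℕ; suc)
open import Data.Nat.GCD using (gcd)
open import Data.Nat using (_≟_)
open import Data.List using (List; filter; length; map)
open import Data.List.Base using (upTo)

-- Euler's totient: φ n = #{ k ∈ {1,…,n} : gcd k n = 1 }.
-- (With this convention φ 0 = 0 and φ 1 = 1.)
φ : ℕ → ℕ
φ n = length (filter (λ k → gcd k n ≟ 1) (map suc (upTo n)))

-- For a prime q, φ(qm) is qφ(m) or (q − 1)φ(m) according as q ∣ m or not, so p ∣ φ(n) with
-- p ∤ n forces a prime factor q ≡ 1 (mod p) of n = ap² + 1.  Its cofactor is then ≡ 1 (mod p)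
-- as well, and writing n = (lp + 1)(kp + 1) with k, l ≥ 1 gives lkp + l + k = ap, whence
-- p ≤ l + k ≤ lk + 1 ≤ a, contradicting a < p.  So the cofactor is 1 and n = q is prime.
module Submission where

open import Defs
open import Data.Bool using (Bool; true; false; _∧_; not)
open import Data.List using ([]; _∷_; filter; length; upTo; applyUpTo; map)
open import Data.List.Properties using (map-upTo)
open import Data.List.Relation.Unary.All using (All; []; _∷_)
open import Data.Nat
import Data.Nat.Coprimality as Coprime
open Coprime using (Coprime; coprime?; coprime-+; coprime-divisor; gcd≡1⇒coprime; coprime⇒gcd≡1)
open import Data.Nat.Divisibility
open import Data.Nat.GCD using (gcd)
open import Data.Nat.ListAction using (product)
open import Data.Nat.Primality using (Prime; prime⇒irreducible; prime⇒nonZero; prime⇒nonTrivial; euclidsLemma)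
open import Data.Nat.Primality.Factorisation using (factorise; PrimeFactorisation)
open import Data.Nat.Properties
open import Data.Nat.Tactic.RingSolver using (solve-∀)
open import Algebra.Properties.CommutativeSemigroup +-commutativeSemigroup using (interchange)
open import Data.Product using (∃-syntax; _×_; _,_)
open import Data.Sum using (_⊎_; inj₁; inj₂)
open import Function using (_∘_; mk⇔)
open import Level using (Level)
open import Relation.Nullary using (¬_; yes; no; does; contradiction)
open import Relation.Nullary.Decidable using (does-⇔; dec-true; dec-false)
open import Relation.Unary using (Pred; Decidable; _≐_; _∩_; ∁)
open import Relation.Unary.Properties using (_∩?_; ∁?; ≐-sym)
open import Relation.Binary.PropositionalEquality

private
  variable
    ℓ ℓ′ : Level
    P : Pred ℕ ℓ
    Q : Pred ℕ ℓ′

indicator : Bool → ℕ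
indicator true  = 1
indicator false = 0

indicator-split : ∀ b c → indicator b ≡ indicator (c ∧ b) + indicator (not c ∧ b)
indicator-split b true  = sym (+-identityʳ _)
indicator-split b false = refl

count : Decidable P → ℕ → ℕ
count P? zero    = 0
count P? (suc n) = indicator (does (P? 0)) + count (P? ∘ suc) n

count-cong : P ≐ Q → (P? : Decidable P) (Q? : Decidable Q) →
             ∀ n → count P? n ≡ count Q? n
count-cong P≐Q          P? Q? zero    = refl
count-cong (P⊆Q , Q⊆P) P? Q? (suc n) =
  cong₂ _+_ (cong indicator (does-⇔ (mk⇔ P⊆Q Q⊆P) (P? 0) (Q? 0)))
            (count-cong (P⊆Q , Q⊆P) (P? ∘ suc) (Q? ∘ suc) n)

count-+ : (P? : Decidable P) → ∀ m n → count P? (m + n) ≡ count P? m + count (P? ∘ (m +_)) n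
count-+ P? zero    n = refl
count-+ P? (suc m) n = trans (cong (indicator (does (P? 0)) +_) (count-+ (P? ∘ suc) m n))
                             (sym (+-assoc (indicator (does (P? 0))) _ _))

count-suc : (P? : Decidable P) → ∀ n → count P? (suc n) ≡ count P? n + indicator (does (P? n))
count-suc P? zero    = +-identityʳ _
count-suc P? (suc n) = trans (cong (indicator (does (P? 0)) +_) (count-suc (P? ∘ suc) n))
                             (sym (+-assoc (indicator (does (P? 0))) _ _))

count-rotate : (P? : Decidable P) → ∀ n → (P n → P 0) → (P 0 → P n) →
               count (P? ∘ suc) n ≡ count P? n
count-rotate P? n Pn→P0 P0→Pn = +-cancelˡ-≡ (indicator (does (P? 0))) _ _ (begin
  indicator (does (P? 0)) + count (P? ∘ suc) n ≡⟨ count-suc P? n ⟩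
  count P? n + indicator (does (P? n))         ≡⟨ cong (λ b → count P? n + indicator b)
                                                       (does-⇔ (mk⇔ Pn→P0 P0→Pn) (P? n) (P? 0)) ⟩
  count P? n + indicator (does (P? 0))         ≡⟨ +-comm (count P? n) _ ⟩
  indicator (does (P? 0)) + count P? n         ∎)
  where open ≡-Reasoning

count-periodic : (P? : Decidable P) → ∀ m → (P ∘ (m +_)) ≐ P → ∀ j → count P? (j * m) ≡ j * count P? m
count-periodic P? m periodic zero    = refl
count-periodic P? m periodic (suc j) = begin
  count P? (m + j * m)                         ≡⟨ count-+ P? m (j * m) ⟩
  count P? m + count (P? ∘ (m +_)) (j * m)     ≡⟨ cong (count P? m +_) (count-cong periodic (P? ∘ (m +_)) P? (j * m)) ⟩
  count P? m + count P? (j * m)                ≡⟨ cong (count P? m +_) (count-periodic P? m periodic j) ⟩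
  count P? m + j * count P? m                  ∎
  where open ≡-Reasoning

count-none : (P? : Decidable P) → ∀ n → (∀ {k} → k < n → ¬ P k) → count P? n ≡ 0
count-none P? zero    none = refl
count-none P? (suc n) none rewrite dec-false (P? 0) (none z<s) =
  count-none (P? ∘ suc) n (none ∘ s<s)

count-split : (Q? : Decidable Q) (P? : Decidable P) →
              ∀ n → count P? n ≡ count (Q? ∩? P?) n + count (∁? Q? ∩? P?) n
count-split Q? P? zero    = refl
count-split Q? P? (suc n) = trans
  (cong₂ _+_ (indicator-split (does (P? 0)) (does (Q? 0))) (count-split (Q? ∘ suc) (P? ∘ suc) n))
  (interchange (indicator (does ((Q? ∩? P?) 0))) (indicator (does ((∁? Q? ∩? P?) 0))) _ _)

count-multiples : ∀ q .{{_ : NonZero q}} (P? : Decidable P) →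
                  ∀ j → count ((q ∣?_) ∩? P?) (j * q) ≡ count (P? ∘ (_* q)) j
count-multiples q P? zero    = refl
count-multiples q@(suc q-1) P? (suc j) = begin
  count D (q + j * q)                                 ≡⟨ count-+ D q (j * q) ⟩
  count D q + count (D ∘ (q +_)) (j * q)              ≡⟨ cong₂ _+_ multiples-below-q shift ⟩
  indicator (does (P? 0)) + count (P? ∘ (_* q) ∘ suc) j ∎
  where
  open ≡-Reasoning
  D = (q ∣?_) ∩? P?
  multiples-below-q : count D q ≡ indicator (does (P? 0))
  multiples-below-q rewrite dec-true (q ∣? 0) (q ∣0) =
    trans (cong (indicator (does (P? 0)) +_)
                (count-none (D ∘ suc) q-1 (λ k<q-1 (q∣1+k , _) → <⇒≱ (s<s k<q-1) (∣⇒≤ q∣1+k))))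
          (+-identityʳ _)
  shift : count (D ∘ (q +_)) (j * q) ≡ count (P? ∘ (_* q) ∘ suc) j
  shift = trans (count-cong ((λ (q∣q+k , Pq+k) → ∣m+n∣m⇒∣n q∣q+k ∣-refl , Pq+k)
                           , (λ (q∣k , Pq+k) → ∣m∣n⇒∣m+n ∣-refl q∣k , Pq+k))
                           (D ∘ (q +_)) ((q ∣?_) ∩? (P? ∘ (q +_))) (j * q))
                (count-multiples q (P? ∘ (q +_)) j)

length-filter-applyUpTo : (P? : Decidable P) (f : ℕ → ℕ) →
                          ∀ n → length (filter P? (applyUpTo f n)) ≡ count (P? ∘ f) n
length-filter-applyUpTo P? f zero = refl
length-filter-applyUpTo P? f (suc n) with does (P? (f 0))
... | true  = cong suc (length-filter-applyUpTo P? (f ∘ suc) n)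
... | false = length-filter-applyUpTo P? (f ∘ suc) n

coprime-∣ˡ : ∀ {d m n} → d ∣ m → Coprime m n → Coprime d n
coprime-∣ˡ d∣m c (e∣d , e∣n) = c (∣-trans e∣d d∣m , e∣n)

coprime-*ˡ : ∀ {m n o} → Coprime m o → Coprime n o → Coprime (m * n) o
coprime-*ˡ c₁ c₂ (d∣mn , d∣o) =
  c₂ (coprime-divisor (λ (e∣d , e∣m) → c₁ (e∣m , ∣-trans e∣d d∣o)) d∣mn , d∣o)

prime∤⇒coprime : ∀ {p n} → Prime p → ¬ p ∣ n → Coprime p n
prime∤⇒coprime pp p∤n (d∣p , d∣n) with prime⇒irreducible pp d∣p
... | inj₁ d≡1  = d≡1
... | inj₂ refl = contradiction d∣n p∤n

prime∣⇒¬coprime : ∀ {p m n} → Prime p → p ∣ m → p ∣ n → ¬ Coprime m n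
prime∣⇒¬coprime pp p∣m p∣n c = nonTrivial⇒≢1 {{prime⇒nonTrivial pp}} (c (p∣m , p∣n))

CoprimeTo : ℕ → Pred ℕ _
CoprimeTo n k = Coprime k n

coprimeTo? : ∀ n → Decidable (CoprimeTo n)
coprimeTo? n k = coprime? k n

coprimeTo-periodic : ∀ n → (CoprimeTo n ∘ (n +_)) ≐ CoprimeTo n
coprimeTo-periodic n = (λ c (d∣k , d∣n) → c (∣m∣n⇒∣m+n d∣n d∣k , d∣n)) , coprime-+

coprimeTo-prime* : ∀ {q} m → Prime q → CoprimeTo (q * m) ≐ (∁ (q ∣_) ∩ CoprimeTo m)
coprimeTo-prime* {q} m pq =
  (λ c → (λ q∣k → prime∣⇒¬coprime pq q∣k (m∣m*n m) c) , λ (d∣k , d∣m) → c (d∣k , ∣-trans d∣m (n∣m*n q)))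
  , λ (q∤k , c) → Coprime.sym (coprime-*ˡ (prime∤⇒coprime pq q∤k) (Coprime.sym c))

coprimeTo-*prime : ∀ {q} m → Prime q → ¬ q ∣ m → (CoprimeTo m ∘ (_* q)) ≐ CoprimeTo m
coprimeTo-*prime m pq q∤m = coprime-∣ˡ (m∣m*n _) , λ c → coprime-*ˡ c (prime∤⇒coprime pq q∤m)

-- φ counts 1, …, n and count counts 0, …, n − 1; the endpoints agree since Coprime 0 n ⇔ Coprime n n.
φ≡count-coprimeTo : ∀ n → φ n ≡ count (coprimeTo? n) n
φ≡count-coprimeTo n = begin
  length (filter (λ k → gcd k n ≟ 1) (map suc (upTo n)))
    ≡⟨ cong (length ∘ filter (λ k → gcd k n ≟ 1)) (map-upTo suc n) ⟩
  length (filter (λ k → gcd k n ≟ 1) (applyUpTo suc n))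
    ≡⟨ length-filter-applyUpTo (λ k → gcd k n ≟ 1) suc n ⟩
  count ((λ k → gcd k n ≟ 1) ∘ suc) n
    ≡⟨ count-cong (gcd≡1⇒coprime , coprime⇒gcd≡1) _ (coprimeTo? n ∘ suc) n ⟩
  count (coprimeTo? n ∘ suc) n
    ≡⟨ count-rotate (coprimeTo? n) n (λ c (_ , d∣n) → c (d∣n , d∣n)) (λ c (_ , d∣n) → c (_ ∣0 , d∣n)) ⟩
  count (coprimeTo? n) n ∎
  where open ≡-Reasoning

-- Count the residues in [0, qm) coprime to m, split by divisibility by q.
prime*φ≡count+φ : ∀ {q} m → Prime q → q * φ m ≡ count (coprimeTo? m ∘ (_* q)) m + φ (q * m)
prime*φ≡count+φ {q} m pq = begin
  q * φ m                                        ≡⟨ cong (q *_) (φ≡count-coprimeTo m) ⟩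
  q * count C m                                  ≡⟨ count-periodic C m (coprimeTo-periodic m) q ⟨
  count C (q * m)                                ≡⟨ count-split (q ∣?_) C (q * m) ⟩
  count ((q ∣?_) ∩? C) (q * m) + count (∁? (q ∣?_) ∩? C) (q * m)
    ≡⟨ cong₂ _+_ multiples non-multiples ⟩
  count (C ∘ (_* q)) m + φ (q * m)               ∎
  where
  open ≡-Reasoning
  instance _ = prime⇒nonZero pq
  C = coprimeTo? m
  multiples : count ((q ∣?_) ∩? C) (q * m) ≡ count (C ∘ (_* q)) m
  multiples = trans (cong (count ((q ∣?_) ∩? C)) (*-comm q m)) (count-multiples q C m)
  non-multiples : count (∁? (q ∣?_) ∩? C) (q * m) ≡ φ (q * m)
  non-multiples = trans (count-cong (≐-sym (coprimeTo-prime* m pq)) _ (coprimeTo? (q * m)) (q * m))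
                        (sym (φ≡count-coprimeTo (q * m)))

φ-prime*-∣ : ∀ {q} m → Prime q → q ∣ m → φ (q * m) ≡ q * φ m
φ-prime*-∣ {q} m pq q∣m = sym (begin
  q * φ m                                  ≡⟨ prime*φ≡count+φ m pq ⟩
  count (coprimeTo? m ∘ (_* q)) m + φ (q * m) ≡⟨ cong (_+ φ (q * m)) no-coprime-multiples ⟩
  φ (q * m)                                ∎)
  where
  open ≡-Reasoning
  no-coprime-multiples : count (coprimeTo? m ∘ (_* q)) m ≡ 0
  no-coprime-multiples = count-none _ m (λ {k} _ → prime∣⇒¬coprime pq (n∣m*n k) q∣m)

φ-prime*-∤ : ∀ {q} m → Prime q → ¬ q ∣ m → φ (q * m) ≡ (q ∸ 1) * φ m
φ-prime*-∤ {suc q-1} m pq q∤m = +-cancelˡ-≡ (φ m) _ _ (begin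
  φ m + φ (suc q-1 * m)                                  ≡⟨ cong (_+ φ (suc q-1 * m)) coprime-multiples ⟩
  count (coprimeTo? m ∘ (_* suc q-1)) m + φ (suc q-1 * m) ≡⟨ prime*φ≡count+φ m pq ⟨
  suc q-1 * φ m                                          ∎)
  where
  open ≡-Reasoning
  coprime-multiples : φ m ≡ count (coprimeTo? m ∘ (_* suc q-1)) m
  coprime-multiples = trans (φ≡count-coprimeTo m)
    (count-cong (≐-sym (coprimeTo-*prime m pq q∤m)) (coprimeTo? m) _ m)

prime∣φ[prime*m] : ∀ {p q} m → Prime p → Prime q → ¬ p ∣ q * m → p ∣ φ (q * m) → p ∣ q ∸ 1 ⊎ p ∣ φ m
prime∣φ[prime*m] {p} {q} m pp pq p∤qm p∣φqm with q ∣? m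
... | yes q∣m with euclidsLemma q (φ m) pp (subst (p ∣_) (φ-prime*-∣ m pq q∣m) p∣φqm)
...   | inj₁ p∣q  = contradiction (∣-trans p∣q (m∣m*n m)) p∤qm
...   | inj₂ p∣φm = inj₂ p∣φm
prime∣φ[prime*m] {p} {q} m pp pq p∤qm p∣φqm | no q∤m =
  euclidsLemma (q ∸ 1) (φ m) pp (subst (p ∣_) (φ-prime*-∤ m pq q∤m) p∣φqm)

HasPrimeFactor≡1Mod : ℕ → ℕ → Set
HasPrimeFactor≡1Mod n p = ∃[ q ] Prime q × q ∣ n × p ∣ q ∸ 1

∣φ[product]⇒hasPrimeFactor≡1Mod : ∀ {p qs} → Prime p → All Prime qs →
  ¬ p ∣ product qs → p ∣ φ (product qs) → HasPrimeFactor≡1Mod (product qs) p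
∣φ[product]⇒hasPrimeFactor≡1Mod pp [] p∤1 p∣φ1 = contradiction p∣φ1 p∤1
∣φ[product]⇒hasPrimeFactor≡1Mod {p} {q ∷ qs} pp (pq ∷ pqs) p∤qm p∣φqm
  with prime∣φ[prime*m] (product qs) pp pq p∤qm p∣φqm
... | inj₁ p∣q∸1 = q , pq , m∣m*n (product qs) , p∣q∸1
... | inj₂ p∣φm
  with r , pr , r∣m , p∣r∸1 ←
         ∣φ[product]⇒hasPrimeFactor≡1Mod pp pqs (λ p∣m → p∤qm (∣-trans p∣m (n∣m*n q))) p∣φm
  = r , pr , ∣-trans r∣m (n∣m*n q) , p∣r∸1

∣φ⇒hasPrimeFactor≡1Mod : ∀ {p n} → Prime p → ¬ p ∣ n → p ∣ φ n → HasPrimeFactor≡1Mod n p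
∣φ⇒hasPrimeFactor≡1Mod {p} {zero}  pp p∤0 _    = contradiction (p ∣0) p∤0
∣φ⇒hasPrimeFactor≡1Mod {p} {suc n} pp p∤n p∣φn =
  subst (λ m → HasPrimeFactor≡1Mod m p) (sym n≡∏)
        (∣φ[product]⇒hasPrimeFactor≡1Mod pp factorsPrime
           (subst (¬_ ∘ (p ∣_)) n≡∏ p∤n) (subst ((p ∣_) ∘ φ) n≡∏ p∣φn))
  where open PrimeFactorisation (factorise (suc n)) renaming (isFactorisation to n≡∏)

m+n≤1+m*n : ∀ m n .{{_ : NonZero m}} .{{_ : NonZero n}} → m + n ≤ suc (m * n)
m+n≤1+m*n (suc m) (suc n) = s≤s (begin
  m + suc n         ≡⟨ +-comm m (suc n) ⟩
  suc n + m         ≤⟨ +-monoʳ-≤ (suc n) (m≤m*n m (suc n)) ⟩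
  suc n + m * suc n ∎)
  where open ≤-Reasoning

cofactor-≡1-mod : ∀ {a p k} m → suc m * suc (k * p) ≡ a * p ^ 2 + 1 → p ∣ m
cofactor-≡1-mod {a} {p} {k} m eq = ∣m+n∣m⇒∣n p∣[mk+k]p+m (n∣m*n (m * k + k))
  where
  expand : ∀ m k p → suc m * suc (k * p) ≡ ((m * k + k) * p + m) + 1
  expand = solve-∀
  p∣[mk+k]p+m : p ∣ (m * k + k) * p + m
  p∣[mk+k]p+m = subst (p ∣_) (+-cancelʳ-≡ 1 _ _ (trans (sym eq) (expand m k p)))
                      (∣-trans (m∣m*n (p ^ 1)) (n∣m*n a))

≡1-mod-factors⇒p≤a : ∀ {a p} k l .{{_ : NonZero k}} .{{_ : NonZero l}} →
                     suc (l * p) * suc (k * p) ≡ a * p ^ 2 + 1 → p ≤ a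
≡1-mod-factors⇒p≤a {a} {zero}  k l eq = z≤n
≡1-mod-factors⇒p≤a {a} {p@(suc _)} k@(suc _) l@(suc _) eq = begin
  p          ≤⟨ ∣⇒≤ p∣l+k ⟩
  l + k      ≤⟨ m+n≤1+m*n l k ⟩
  suc (l * k) ≤⟨ *-cancelʳ-< p (l * k) a (subst (l * k * p <_) reduced (m<m+n (l * k * p) z<s)) ⟩
  a          ∎
  where
  open ≤-Reasoning
  expand : ∀ l k p → suc (l * p) * suc (k * p) ≡ (l * k * p + (l + k)) * p + 1
  expand = solve-∀
  a*p^2≡a*p*p : a * p ^ 2 ≡ a * p * p
  a*p^2≡a*p*p = trans (cong (λ x → a * (p * x)) (*-identityʳ p)) (sym (*-assoc a p p))
  reduced : l * k * p + (l + k) ≡ a * p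
  reduced = *-cancelʳ-≡ _ _ p (+-cancelʳ-≡ 1 _ _ (trans (sym (expand l k p)) (trans eq (cong (_+ 1) a*p^2≡a*p*p))))
  p∣l+k : p ∣ l + k
  p∣l+k = ∣m+n∣m⇒∣n (subst (p ∣_) (sym reduced) (n∣m*n a)) (n∣m*n (l * k))

cofactor≡1 : ∀ {a p} k m .{{_ : NonZero k}} → a < p → m * suc (k * p) ≡ a * p ^ 2 + 1 → m ≡ 1
cofactor≡1 {a} {p} k zero          a<p eq = contradiction (sym eq) (m+1+n≢0 (a * p ^ 2))
cofactor≡1         k (suc zero)    a<p eq = refl
cofactor≡1 {a} {p} k (suc (suc m)) a<p eq with cofactor-≡1-mod {a} {p} {k} (suc m) eq
... | divides zero ()
... | divides (suc l) suc[m]≡l*p = contradiction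
  (≡1-mod-factors⇒p≤a {a} {p} k (suc l) (trans (cong (λ x → suc x * suc (k * p)) (sym suc[m]≡l*p)) eq))
  (<⇒≱ a<p)

hasPrimeFactor≡1Mod⇒prime : ∀ {a p} → a < p → HasPrimeFactor≡1Mod (a * p ^ 2 + 1) p → Prime (a * p ^ 2 + 1)
hasPrimeFactor≡1Mod⇒prime {a} {p} a<p (q , pq , divides m n≡m*q , divides k q∸1≡k*p) =
  subst Prime q≡n pq
  where
  q≡1+k*p : q ≡ suc (k * p)
  q≡1+k*p = trans (sym (suc-pred q {{prime⇒nonZero pq}})) (cong suc q∸1≡k*p)
  instance
    _ = prime⇒nonTrivial pq
    k≢0 : NonZero k
    k≢0 = ≢-nonZero λ { refl → nonTrivial⇒≢1 q≡1+k*p }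
  q≡n : q ≡ a * p ^ 2 + 1
  q≡n = sym (begin
    a * p ^ 2 + 1 ≡⟨ n≡m*q ⟩
    m * q         ≡⟨ cong (_* q) (cofactor≡1 k m a<p (trans (cong (m *_) (sym q≡1+k*p)) (sym n≡m*q))) ⟩
    1 * q         ≡⟨ *-identityˡ q ⟩
    q             ∎)
    where open ≡-Reasoning

lemma4p1 : (p a : ℕ) → Prime p → ¬ (2 ∣ p) → 0 < a → a < p →
    p ∣ φ (a * p ^ 2 + 1) → Prime (a * p ^ 2 + 1)
lemma4p1 p a p-prime _ _ a<p p∣φn =
  hasPrimeFactor≡1Mod⇒prime a<p (∣φ⇒hasPrimeFactor≡1Mod p-prime p∤n p∣φn)
  where
  p∤n : ¬ p ∣ a * p ^ 2 + 1
  p∤n p∣n = nonTrivial⇒≢1 {{prime⇒nonTrivial p-prime}}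
    (∣1⇒≡1 (∣m+n∣m⇒∣n p∣n (∣-trans (m∣m*n (p ^ 1)) (n∣m*n a))))
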